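{- Let $p$ be a prime and $n\ge1$. Let $t\le n$, let $I\subseteq\{0,1,\dots,n-1\}$ with $|I|=t$ and $n-1\in I$, and put $S_I=\{\sum_{i\in I}a_ip^i \bmod p^n:\ a_i\in\{0,1,\dots,p-1\}\}\subseteq\mathbb{Z}_{p^n}$. Let $V\subseteq\mathbb{Z}_{p^n}$ with $|V|=p^t$ and $0\in V$. If $V-V=\{v-v':v,v'\in V\}\subseteq S_I$, then $V=S_I$.
   Context: $\mathbb{Z}_{p^n}$ is the additive cyclic group of integers modulo $p^n$. -}

module Defs where

open import Data.Nat using (ℕ; zero; suc; _+_; _*_; _∸_; _^_)
open import Data.Nat.DivMod using (_%_)
open import Data.Fin using (Fin; toℕ)
import Data.Fin as F
open import Data.Fin.Subset using (Subset; inside; outside)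
open import Data.Vec using (lookup)
open import Data.Product using (Σ)
open import Relation.Binary.PropositionalEquality using (_≡_)

-- reduction modulo m (for m = 0 we leave x unchanged; only m = p^n > 0 is used)
modN : ℕ → ℕ → ℕ
modN x zero    = x
modN x (suc k) = x % suc k

sumFin : (n : ℕ) → (Fin n → ℕ) → ℕ
sumFin zero    f = 0
sumFin (suc n) f = f F.zero + sumFin n (λ i → f (F.suc i))

term : (p : ℕ) {n : ℕ} → Subset n → (Fin n → Fin p) → Fin n → ℕ
term p I a i with lookup I i
... | inside  = toℕ (a i) * p ^ toℕ i
... | outside = 0

-- membership in S_I ⊆ ℤ_{p^n}  (elements of ℤ_{p^n} are Fin (p ^ n))
-- x ∈ S_I  iff  x = Σ_{i∈I} a_i p^i mod p^n for some digits a_i ∈ {0,…,p-1}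
-- (digits a_i for i ∉ I are irrelevant)
InS : (p n : ℕ) → Subset n → Fin (p ^ n) → Set
InS p n I x = Σ (Fin n → Fin p) λ a → toℕ x ≡ modN (sumFin n (term p I a)) (p ^ n)

-- v - v' in ℤ_{p^n}, as a natural number representative in [0, p^n)
subMod : (p n : ℕ) → Fin (p ^ n) → Fin (p ^ n) → ℕ
subMod p n v v' = modN (toℕ v + (p ^ n ∸ toℕ v')) (p ^ n)

InSℕ : (p n : ℕ) → Subset n → ℕ → Set
InSℕ p n I y = Σ (Fin n → Fin p) λ a → y ≡ modN (sumFin n (term p I a)) (p ^ n)

-- V contains 0, so every v = v − 0 lies in S_I: V ⊆ S_I. The sums Σ_{i∈I} a_i p^i take at most
-- p^|I| = p^t = |V| values, so S_I has at most |V| elements and the inclusion is an equality.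
module Submission where

open import Defs
open import Data.Nat using (ℕ; _≤_; _∸_; _^_)
open import Data.Nat.Primality using (Prime)
open import Data.Fin using (Fin; toℕ)
open import Data.Fin.Subset using (Subset; _∈_; ∣_∣)
open import Data.Product using (_×_)
open import Relation.Binary.PropositionalEquality using (_≡_)

open import Data.Nat using (zero; suc; _+_; _*_; pred; z≤n; s≤s)
open import Data.Nat.Properties
  using (+-suc; *-identityʳ; *-zeroʳ; *-distribˡ-+; *-commutativeSemigroup; ≤-trans; ≤-reflexive; ≤⇒≯)
open import Data.Nat.DivMod using (m<n⇒m%n≡m; [m+n]%n≡m%n)
import Data.Fin as F
open import Data.Fin.Properties using (toℕ<n)
open import Data.Fin.Subset using (inside; outside; _∪_; ⁅_⁆)
open import Data.Fin.Subset.Properties using (_∈?_; p⊂q⇒∣p∣<∣q∣; p⊆p∪q; x∈p∪q⁺; x∈p∪q⁻; x∈⁅x⁆; x∈⁅y⁆⇒x≡y)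
open import Data.Vec using (lookup)
import Data.Vec as Vec
open Vec using () renaming (_∷_ to _∷ᵥ_; [] to []ᵥ)
open import Data.List using (List; _∷_; []; length; map; _++_; upTo; cartesianProductWith; [_])
open import Data.List.Properties using (length-map; length-++; length-upTo)
open import Data.List.Membership.Propositional using () renaming (_∈_ to _∈ₗ_)
open import Data.List.Membership.Propositional.Properties
  using (∈-∃++; ∈-++⁻; ∈-++⁺ˡ; ∈-++⁺ʳ; ∈-map⁺; ∈-upTo⁺; ∈-cartesianProductWith⁺)
open import Data.List.Relation.Unary.Any using (here; there)
open import Data.Product using (Σ; _,_)
open import Data.Sum using (inj₁; inj₂)
open import Function using (_∘_)
open import Relation.Nullary using (yes; no; contradiction)
open import Relation.Binary.PropositionalEquality using (_≢_; refl; sym; trans; cong; cong₂; subst; module ≡-Reasoning)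
open import Algebra.Properties.CommutativeSemigroup *-commutativeSemigroup using (x∙yz≈y∙xz)

∈-++-∷⁻ : ∀ us vs {y z : ℕ} → z ∈ₗ us ++ y ∷ vs → z ≢ y → z ∈ₗ us ++ vs
∈-++-∷⁻ us vs z∈ z≢y with ∈-++⁻ us z∈
... | inj₁ z∈us          = ∈-++⁺ˡ z∈us
... | inj₂ (here z≡y)    = contradiction z≡y z≢y
... | inj₂ (there z∈vs)  = ∈-++⁺ʳ us z∈vs

length-++-∷ : ∀ us vs (y : ℕ) → length (us ++ y ∷ vs) ≡ suc (length (us ++ vs))
length-++-∷ us vs y = begin
  length (us ++ y ∷ vs)          ≡⟨ length-++ us ⟩
  length us + suc (length vs)    ≡⟨ +-suc (length us) (length vs) ⟩
  suc (length us + length vs)    ≡⟨ cong suc (length-++ us) ⟨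
  suc (length (us ++ vs))        ∎
  where open ≡-Reasoning

length-*-cartesianProductWith : ∀ (f : ℕ → ℕ → ℕ) xs ys →
  length (cartesianProductWith f xs ys) ≡ length xs * length ys
length-*-cartesianProductWith f []       ys = refl
length-*-cartesianProductWith f (x ∷ xs) ys =
  trans (length-++ (map (f x) ys))
        (cong₂ _+_ (length-map (f x) ys) (length-*-cartesianProductWith f xs ys))

-- Passing to the tail of the subset shifts the indices down by one, hence the map pred.
∣p∣≤length : ∀ {m} (p : Subset m) (L : List ℕ) → (∀ {x} → x ∈ p → toℕ x ∈ₗ L) → ∣ p ∣ ≤ length L
∣p∣≤length []ᵥ           L p⊆L = z≤n
∣p∣≤length (outside ∷ᵥ p) L p⊆L =
  subst (∣ p ∣ ≤_) (length-map pred L)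
    (∣p∣≤length p (map pred L) (∈-map⁺ pred ∘ p⊆L ∘ Vec.there))
∣p∣≤length (inside ∷ᵥ p)  L p⊆L with us , vs , refl ← ∈-∃++ (p⊆L Vec.here) =
  ≤-trans (s≤s (∣p∣≤length p (map pred (us ++ vs)) λ x∈p →
                 ∈-map⁺ pred (∈-++-∷⁻ us vs (p⊆L (Vec.there x∈p)) λ ())))
          (≤-reflexive (trans (cong suc (length-map pred (us ++ vs))) (sym (length-++-∷ us vs 0))))

∈-of-length≤∣p∣ : ∀ {m} (p : Subset m) (L : List ℕ) → (∀ {x} → x ∈ p → toℕ x ∈ₗ L) →
  length L ≤ ∣ p ∣ → ∀ x → toℕ x ∈ₗ L → x ∈ p
∈-of-length≤∣p∣ p L p⊆L L≤p x x∈L with x ∈? p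
... | yes x∈p = x∈p
... | no  x∉p = contradiction (≤-trans ∣p∣<∣p∪x∣ (∣p∣≤length (p ∪ ⁅ x ⁆) L p∪x⊆L)) (≤⇒≯ L≤p)
  where
  ∣p∣<∣p∪x∣ = p⊂q⇒∣p∣<∣q∣ (p⊆p∪q ⁅ x ⁆ , x , x∈p∪q⁺ (inj₂ (x∈⁅x⁆ x)) , x∉p)
  p∪x⊆L : ∀ {y} → y ∈ p ∪ ⁅ x ⁆ → toℕ y ∈ₗ L
  p∪x⊆L y∈ with x∈p∪q⁻ p ⁅ x ⁆ y∈
  ... | inj₁ y∈p = p⊆L y∈p
  ... | inj₂ y∈x = subst (λ z → toℕ z ∈ₗ L) (sym (x∈⁅y⁆⇒x≡y x y∈x)) x∈L

sumFin-cong : ∀ n {f g : Fin n → ℕ} → (∀ i → f i ≡ g i) → sumFin n f ≡ sumFin n g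
sumFin-cong zero    f≗g = refl
sumFin-cong (suc n) f≗g = cong₂ _+_ (f≗g F.zero) (sumFin-cong n (f≗g ∘ F.suc))

sumFin-*ˡ : ∀ c n (f : Fin n → ℕ) → sumFin n (λ i → c * f i) ≡ c * sumFin n f
sumFin-*ˡ c zero    f = sym (*-zeroʳ c)
sumFin-*ˡ c (suc n) f =
  trans (cong (c * f F.zero +_) (sumFin-*ˡ c n (f ∘ F.suc)))
        (sym (*-distribˡ-+ c (f F.zero) _))

term-suc : ∀ p {n} b (I : Subset n) (a : Fin (suc n) → Fin p) (i : Fin n) →
  term p (b ∷ᵥ I) a (F.suc i) ≡ p * term p I (a ∘ F.suc) i
term-suc p b I a i with lookup I i
... | inside  = x∙yz≈y∙xz (toℕ (a (F.suc i))) p (p ^ toℕ i)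
... | outside = sym (*-zeroʳ p)

sumFin-term-∷ : ∀ p n b (I : Subset n) (a : Fin (suc n) → Fin p) →
  sumFin (suc n) (term p (b ∷ᵥ I) a) ≡ term p (b ∷ᵥ I) a F.zero + p * sumFin n (term p I (a ∘ F.suc))
sumFin-term-∷ p n b I a = cong (term p (b ∷ᵥ I) a F.zero +_)
  (trans (sumFin-cong n (term-suc p b I a)) (sumFin-*ˡ p n (term p I (a ∘ F.suc))))

-- Every value of Σ_{i∈I} a_i p^i (not reduced mod p^n), possibly with repetitions.
digitSums : ∀ (p : ℕ) {n} → Subset n → List ℕ
digitSums p []ᵥ           = [ 0 ]
digitSums p (inside ∷ᵥ I)  = cartesianProductWith (λ d s → d + p * s) (upTo p) (digitSums p I)
digitSums p (outside ∷ᵥ I) = map (p *_) (digitSums p I)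

length-digitSums : ∀ p {n} (I : Subset n) → length (digitSums p I) ≡ p ^ ∣ I ∣
length-digitSums p []ᵥ           = refl
length-digitSums p (inside ∷ᵥ I)  =
  trans (length-*-cartesianProductWith _ (upTo p) (digitSums p I))
        (cong₂ _*_ (length-upTo p) (length-digitSums p I))
length-digitSums p (outside ∷ᵥ I) = trans (length-map (p *_) (digitSums p I)) (length-digitSums p I)

sumFin-term∈digitSums : ∀ p n (I : Subset n) (a : Fin n → Fin p) → sumFin n (term p I a) ∈ₗ digitSums p I
sumFin-term∈digitSums p zero    []ᵥ           a = here refl
sumFin-term∈digitSums p (suc n) (inside ∷ᵥ I)  a =
  subst (_∈ₗ digitSums p (inside ∷ᵥ I))
    (sym (trans (sumFin-term-∷ p n inside I a) (cong (_+ p * sumFin n (term p I (a ∘ F.suc))) (*-identityʳ (toℕ (a F.zero))))))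
    (∈-cartesianProductWith⁺ _ (∈-upTo⁺ (toℕ<n (a F.zero))) (sumFin-term∈digitSums p n I (a ∘ F.suc)))
sumFin-term∈digitSums p (suc n) (outside ∷ᵥ I) a =
  subst (_∈ₗ digitSums p (outside ∷ᵥ I)) (sym (sumFin-term-∷ p n outside I a))
    (∈-map⁺ (p *_) (sumFin-term∈digitSums p n I (a ∘ F.suc)))

inhabited⇒zero : ∀ {m} → Fin m → Σ (Fin m) λ z → toℕ z ≡ 0
inhabited⇒zero {suc m} _ = F.zero , refl

modN-+-self : ∀ m (x : Fin m) → modN (toℕ x + m) m ≡ toℕ x
modN-+-self (suc k) x = trans ([m+n]%n≡m%n (toℕ x) (suc k)) (m<n⇒m%n≡m (toℕ<n x))

subMod-zeroʳ : ∀ p n (x z : Fin (p ^ n)) → toℕ z ≡ 0 → subMod p n x z ≡ toℕ x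
subMod-zeroʳ p n x z z≡0 rewrite z≡0 = modN-+-self (p ^ n) x

lemma2p10 : (p n t : ℕ) → Prime p → 1 ≤ n → t ≤ n →
    (I : Subset n) → ∣ I ∣ ≡ t → (∀ (i : Fin n) → toℕ i ≡ n ∸ 1 → i ∈ I) →
    (V : Subset (p ^ n)) → ∣ V ∣ ≡ p ^ t → (∀ (z : Fin (p ^ n)) → toℕ z ≡ 0 → z ∈ V) →
    (∀ (v v′ : Fin (p ^ n)) → v ∈ V → v′ ∈ V → InSℕ p n I (subMod p n v v′)) →
    (∀ (x : Fin (p ^ n)) → (x ∈ V → InS p n I x) × (InS p n I x → x ∈ V))
lemma2p10 p n t _ _ _ I ∣I∣≡t _ V ∣V∣≡p^t 0∈V V-V⊆S x = V⊆S x , S⊆V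
  where
  V⊆S : ∀ y → y ∈ V → InS p n I y
  V⊆S y y∈V with z , z≡0 ← inhabited⇒zero y with a , y−z≡ ← V-V⊆S y z y∈V (0∈V z z≡0) =
    a , trans (sym (subMod-zeroʳ p n y z z≡0)) y−z≡

  S : List ℕ
  S = map (λ s → modN s (p ^ n)) (digitSums p I)

  InS⇒∈S : ∀ y → InS p n I y → toℕ y ∈ₗ S
  InS⇒∈S y (a , y≡) = subst (_∈ₗ S) (sym y≡) (∈-map⁺ _ (sumFin-term∈digitSums p n I a))

  length-S : length S ≡ ∣ V ∣
  length-S = trans (length-map _ (digitSums p I))
               (trans (length-digitSums p I) (trans (cong (p ^_) ∣I∣≡t) (sym ∣V∣≡p^t)))

  S⊆V : InS p n I x → x ∈ V
  S⊆V x∈S = ∈-of-length≤∣p∣ V S (λ {y} y∈V → InS⇒∈S y (V⊆S y y∈V)) (≤-reflexive length-S) x (InS⇒∈S x x∈S)
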